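{- Let $t\equiv 2\pmod 4$. The set of $4$-subsets of $\mathbb{Z}_t\times\mathbb{Z}_4$ $$\{\{(x,i),(y,i),(x,i+1),(y,i+1)\} : x,y\in\mathbb{Z}_t,\ x\neq y,\ i\in\{0,2\}\}$$ can be partitioned into $t-1$ parallel classes on $\mathbb{Z}_t\times\mathbb{Z}_4$.
   Context: A parallel class on a set $V$ is a set of pairwise disjoint $4$-subsets of $V$ whose union is $V$. -}

module Defs where

open import Data.Nat using (ℕ)
open import Data.Fin using (Fin; zero; suc; _<_)
open import Data.Product using (_×_; _,_; Σ; ∃; Σ-syntax)
open import Data.Sum using (_⊎_)
open import Data.Empty using (⊥)
open import Relation.Binary.PropositionalEquality using (_≡_; _≢_)

Point : ℕ → Set
Point t = Fin t × Fin 4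

Subset4 : ℕ → Set₁
Subset4 t = Point t → Set

-- The row i ∈ {0,2} is encoded by j : Fin 2 (i = 2j); lo j = i, hi j = i+1 (mod 4).
lo : Fin 2 → Fin 4
lo zero = zero
lo (suc zero) = suc (suc zero)

hi : Fin 2 → Fin 4
hi zero = suc zero
hi (suc zero) = suc (suc (suc zero))

-- Index set of the family of blocks: unordered pairs {x,y} (x ≠ y), listed
-- once each via x < y, together with the row index i ∈ {0,2}.
record BlockIx (t : ℕ) : Set where
  constructor blockIx
  field
    x   : Fin t
    y   : Fin t
    x<y : x < y
    j   : Fin 2

block : ∀ {t} → BlockIx t → Subset4 t
block (blockIx x y _ j) p =
  (p ≡ (x , lo j)) ⊎ (p ≡ (y , lo j)) ⊎ (p ≡ (x , hi j)) ⊎ (p ≡ (y , hi j))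

Disjoint : ∀ {t} → Subset4 t → Subset4 t → Set
Disjoint A B = ∀ p → A p → B p → ⊥

IsParallelClass : ∀ t → (BlockIx t → Set) → Set
IsParallelClass t inClass =
  (∀ b b' → inClass b → inClass b' → b ≢ b' → Disjoint (block b) (block b'))
  × (∀ (p : Point t) → Σ[ b ∈ BlockIx t ] (inClass b × block b p))

PartitionIntoParallelClasses : ∀ t → ℕ → Set
PartitionIntoParallelClasses t k =
  Σ[ cls ∈ (BlockIx t → Fin k) ] (∀ (c : Fin k) → IsParallelClass t (λ b → cls b ≡ c))

-- Only evenness of t is used: a one-factorization of the complete graph K_t
-- (a symmetric edge colouring with t - 1 colours in which every vertex meets
-- every colour exactly once) turns into the required partition by letting
-- the two blocks over an edge {x, y} (rows {0,1} and {2,3}) inherit its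
-- colour; the blocks of one colour through a point are then pinned down by
-- its column's partner and its row. For t = n + 1 with n odd, the classical
-- round-robin factorization on Z_n ∪ {∞} colours {a, b} by a + b and {a, ∞}
-- by 2a, which is a valid colouring because 2 is invertible modulo n.
module Submission where

open import Defs
open import Data.Nat using (ℕ; suc; _+_; _*_; _%_; _/_; _∸_; NonZero)
open import Data.Nat.Properties using (+-assoc; *-assoc; +-comm; <⇒≤; m+[n∸m]≡n; m∸n+n≡m)
open import Data.Nat.DivMod using (_mod_; m≡m%n+[m/n]*n; m<n⇒m%n≡m; m%n%n≡m%n; m%n<n; %-distribˡ-+; %-distribˡ-*; %-remove-+ˡ; [m+kn]%n≡m%n)
open import Data.Nat.Divisibility using (∣-refl)
open import Data.Nat.Tactic.RingSolver using (solve-∀)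
open import Data.Fin using (Fin; zero; suc; toℕ; _<_)
open import Data.Fin.Properties using (_≟_; <-cmp; <-asym; <-irrelevant; <⇒≢; suc-injective; toℕ-injective; toℕ-fromℕ<; toℕ<n)
open import Data.Product using (_×_; _,_)
open import Data.Sum using (_⊎_; inj₁; inj₂)
open import Data.Empty using (⊥-elim)
open import Relation.Nullary using (yes; no)
open import Relation.Binary using (tri<; tri≈; tri>)
open import Relation.Binary.PropositionalEquality using (_≡_; _≢_; refl; sym; trans; cong; cong₂; subst; ≢-sym; module ≡-Reasoning)

InRow : Fin 2 → Fin 4 → Set
InRow j r = r ≡ lo j ⊎ r ≡ hi j

row : Fin 4 → Fin 2
row zero = zero
row (suc zero) = zero
row (suc (suc _)) = suc zero

inRow-row : ∀ r → InRow (row r) r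
inRow-row zero = inj₁ refl
inRow-row (suc zero) = inj₂ refl
inRow-row (suc (suc zero)) = inj₁ refl
inRow-row (suc (suc (suc zero))) = inj₂ refl

inRow⇒row≡ : ∀ {j r} → InRow j r → row r ≡ j
inRow⇒row≡ {zero} (inj₁ refl) = refl
inRow⇒row≡ {zero} (inj₂ refl) = refl
inRow⇒row≡ {suc zero} (inj₁ refl) = refl
inRow⇒row≡ {suc zero} (inj₂ refl) = refl

module _ {t : ℕ} where

  ∈-block⇒ : ∀ {x y : Fin t} {x<y j z r} → block (blockIx x y x<y j) (z , r) → (z ≡ x ⊎ z ≡ y) × InRow j r
  ∈-block⇒ (inj₁ refl) = inj₁ refl , inj₁ refl
  ∈-block⇒ (inj₂ (inj₁ refl)) = inj₂ refl , inj₁ refl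
  ∈-block⇒ (inj₂ (inj₂ (inj₁ refl))) = inj₁ refl , inj₂ refl
  ∈-block⇒ (inj₂ (inj₂ (inj₂ refl))) = inj₂ refl , inj₂ refl

  ∈-blockˡ : ∀ {x y : Fin t} {x<y j r} → InRow j r → block (blockIx x y x<y j) (x , r)
  ∈-blockˡ (inj₁ refl) = inj₁ refl
  ∈-blockˡ (inj₂ refl) = inj₂ (inj₂ (inj₁ refl))

  ∈-blockʳ : ∀ {x y : Fin t} {x<y j r} → InRow j r → block (blockIx x y x<y j) (y , r)
  ∈-blockʳ (inj₁ refl) = inj₂ (inj₁ refl)
  ∈-blockʳ (inj₂ refl) = inj₂ (inj₂ (inj₂ refl))

  pairIx : (x y : Fin t) → x ≢ y → Fin 2 → BlockIx t
  pairIx x y x≢y j with <-cmp x y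
  ... | tri< x<y _ _ = blockIx x y x<y j
  ... | tri≈ _ x≡y _ = ⊥-elim (x≢y x≡y)
  ... | tri> _ _ y<x = blockIx y x y<x j

  pairIx-∋ : ∀ x y (x≢y : x ≢ y) {j r} → InRow j r → block (pairIx x y x≢y j) (x , r)
  pairIx-∋ x y x≢y r∈j with <-cmp x y
  ... | tri< x<y _ _ = ∈-blockˡ {x<y = x<y} r∈j
  ... | tri≈ _ x≡y _ = ⊥-elim (x≢y x≡y)
  ... | tri> _ _ y<x = ∈-blockʳ {x<y = y<x} r∈j

  pairIx-unordered : ∀ {x y x' y' : Fin t} (x≢y : x ≢ y) (x'<y' : x' < y') j →
                     (x ≡ x' × y ≡ y') ⊎ (x ≡ y' × y ≡ x') → pairIx x y x≢y j ≡ blockIx x' y' x'<y' j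
  pairIx-unordered {x} {y} x≢y x'<y' j (inj₁ (refl , refl)) with <-cmp x y
  ... | tri< x<y _ _ = cong (λ x<y → blockIx x y x<y j) (<-irrelevant x<y x'<y')
  ... | tri≈ _ x≡y _ = ⊥-elim (x≢y x≡y)
  ... | tri> _ _ y<x = ⊥-elim (<-asym x'<y' y<x)
  pairIx-unordered {x} {y} x≢y x'<y' j (inj₂ (refl , refl)) with <-cmp x y
  ... | tri< x<y _ _ = ⊥-elim (<-asym x'<y' x<y)
  ... | tri≈ _ x≡y _ = ⊥-elim (x≢y x≡y)
  ... | tri> _ _ y<x = cong (λ y<x → blockIx y x y<x j) (<-irrelevant y<x x'<y')

record OneFactorization (t k : ℕ) : Set where
  field
    colour           : Fin t → Fin t → Fin k
    colour-sym       : ∀ x y → colour x y ≡ colour y x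
    partner          : Fin k → Fin t → Fin t
    partner-≢        : ∀ c x → partner c x ≢ x
    colour-partner   : ∀ c x → colour x (partner c x) ≡ c
    colour-injective : ∀ x {y y'} → y ≢ x → y' ≢ x → colour x y ≡ colour x y' → y ≡ y'

  partner-unique : ∀ {c x y} → y ≢ x → colour x y ≡ c → partner c x ≡ y
  partner-unique {c} {x} y≢x e = colour-injective x (partner-≢ c x) y≢x (trans (colour-partner c x) (sym e))

module _ {t k : ℕ} (F : OneFactorization t k) where
  open OneFactorization F

  classOf : BlockIx t → Fin k
  classOf (blockIx x y _ _) = colour x y

  pairIx-class : ∀ x y (x≢y : x ≢ y) j → classOf (pairIx x y x≢y j) ≡ colour x y
  pairIx-class x y x≢y j with <-cmp x y
  ... | tri< _ _ _ = refl
  ... | tri≈ _ x≡y _ = ⊥-elim (x≢y x≡y)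
  ... | tri> _ _ _ = colour-sym y x

  blockAt : Fin k → Point t → BlockIx t
  blockAt c (z , r) = pairIx z (partner c z) (≢-sym (partner-≢ c z)) (row r)

  blockAt-class : ∀ c p → classOf (blockAt c p) ≡ c
  blockAt-class c (z , r) = trans (pairIx-class z (partner c z) _ (row r)) (colour-partner c z)

  blockAt-∋ : ∀ c p → block (blockAt c p) p
  blockAt-∋ c (z , r) = pairIx-∋ z (partner c z) _ (inRow-row r)

  blockAt-unique : ∀ {c} b {p} → classOf b ≡ c → block b p → blockAt c p ≡ b
  blockAt-unique {c} (blockIx x y x<y j) {z , r} e p∈b with ∈-block⇒ {x<y = x<y} p∈b
  ... | inj₁ refl , r∈j rewrite inRow⇒row≡ r∈j =
    pairIx-unordered (≢-sym (partner-≢ c x)) x<y j (inj₁ (refl , partner-unique (≢-sym (<⇒≢ x<y)) e))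
  ... | inj₂ refl , r∈j rewrite inRow⇒row≡ r∈j =
    pairIx-unordered (≢-sym (partner-≢ c y)) x<y j (inj₂ (refl , partner-unique (<⇒≢ x<y) (trans (colour-sym y x) e)))

  oneFactorization⇒partition : PartitionIntoParallelClasses t k
  oneFactorization⇒partition = classOf , λ c → disjoint c , λ p → blockAt c p , blockAt-class c p , blockAt-∋ c p
    where
    disjoint : ∀ c b b' → classOf b ≡ c → classOf b' ≡ c → b ≢ b' → Disjoint (block b) (block b')
    disjoint c b b' e e' b≢b' p p∈b p∈b' = b≢b' (trans (sym (blockAt-unique b e p∈b)) (blockAt-unique b' e' p∈b'))

module Modular (n : ℕ) .{{_ : NonZero n}} where

  infixl 6 _⊕_ _⊖_

  _⊕_ : Fin n → Fin n → Fin n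
  a ⊕ b = (toℕ a + toℕ b) mod n

  _⊖_ : Fin n → Fin n → Fin n
  c ⊖ a = ((n ∸ toℕ a) + toℕ c) mod n

  toℕ-mod : ∀ u → toℕ (u mod n) ≡ u % n
  toℕ-mod u = toℕ-fromℕ< (m%n<n u n)

  mod-≡ : ∀ u {a : Fin n} → u % n ≡ toℕ a → u mod n ≡ a
  mod-≡ u e = toℕ-injective (trans (toℕ-mod u) e)

  toℕ%n : ∀ (a : Fin n) → toℕ a % n ≡ toℕ a
  toℕ%n a = m<n⇒m%n≡m (toℕ<n a)

  +-toℕ-mod : ∀ u v → (u + toℕ (v mod n)) % n ≡ (u + v) % n
  +-toℕ-mod u v = begin
    (u + toℕ (v mod n)) % n  ≡⟨ cong (λ w → (u + w) % n) (toℕ-mod v) ⟩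
    (u + v % n) % n          ≡⟨ %-distribˡ-+ u (v % n) n ⟩
    (u % n + v % n % n) % n  ≡⟨ cong (λ w → (u % n + w) % n) (m%n%n≡m%n v n) ⟩
    (u % n + v % n) % n      ≡⟨ %-distribˡ-+ u v n ⟨
    (u + v) % n              ∎
    where open ≡-Reasoning

  *-toℕ-mod : ∀ u v → (toℕ (u mod n) * v) % n ≡ (u * v) % n
  *-toℕ-mod u v = begin
    (toℕ (u mod n) * v) % n  ≡⟨ cong (λ w → (w * v) % n) (toℕ-mod u) ⟩
    (u % n * v) % n          ≡⟨ %-distribˡ-* (u % n) v n ⟩
    (u % n % n * (v % n)) % n ≡⟨ cong (λ w → (w * (v % n)) % n) (m%n%n≡m%n u n) ⟩
    (u % n * (v % n)) % n    ≡⟨ %-distribˡ-* u v n ⟨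
    (u * v) % n              ∎
    where open ≡-Reasoning

  ⊕-comm : ∀ a b → a ⊕ b ≡ b ⊕ a
  ⊕-comm a b = cong (_mod n) (+-comm (toℕ a) (toℕ b))

  a⊕[c⊖a]≡c : ∀ a c → a ⊕ (c ⊖ a) ≡ c
  a⊕[c⊖a]≡c a c = mod-≡ _ (begin
    (toℕ a + toℕ (c ⊖ a)) % n      ≡⟨ +-toℕ-mod (toℕ a) _ ⟩
    (toℕ a + ((n ∸ toℕ a) + toℕ c)) % n ≡⟨ cong (_% n) (+-assoc (toℕ a) _ _) ⟨
    (toℕ a + (n ∸ toℕ a) + toℕ c) % n ≡⟨ cong (λ w → (w + toℕ c) % n) (m+[n∸m]≡n (<⇒≤ (toℕ<n a))) ⟩
    (n + toℕ c) % n                 ≡⟨ %-remove-+ˡ (toℕ c) ∣-refl ⟩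
    toℕ c % n                       ≡⟨ toℕ%n c ⟩
    toℕ c                           ∎)
    where open ≡-Reasoning

  [a⊕b]⊖a≡b : ∀ a b → (a ⊕ b) ⊖ a ≡ b
  [a⊕b]⊖a≡b a b = mod-≡ _ (begin
    ((n ∸ toℕ a) + toℕ (a ⊕ b)) % n     ≡⟨ +-toℕ-mod (n ∸ toℕ a) _ ⟩
    ((n ∸ toℕ a) + (toℕ a + toℕ b)) % n ≡⟨ cong (_% n) (+-assoc (n ∸ toℕ a) _ _) ⟨
    ((n ∸ toℕ a) + toℕ a + toℕ b) % n   ≡⟨ cong (λ w → (w + toℕ b) % n) (m∸n+n≡m (<⇒≤ (toℕ<n a))) ⟩
    (n + toℕ b) % n                     ≡⟨ %-remove-+ˡ (toℕ b) ∣-refl ⟩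
    toℕ b % n                           ≡⟨ toℕ%n b ⟩
    toℕ b                               ∎)
    where open ≡-Reasoning

  ⊕-cancelˡ : ∀ a {b b'} → a ⊕ b ≡ a ⊕ b' → b ≡ b'
  ⊕-cancelˡ a {b} {b'} e = trans (sym ([a⊕b]⊖a≡b a b)) (trans (cong (_⊖ a) e) ([a⊕b]⊖a≡b a b'))

module RoundRobin (m : ℕ) where

  private
    n : ℕ
    n = suc (m * 2)

  open Modular n

  -- m + 1 is the inverse of 2 modulo n = 2m + 1.
  half : Fin n → Fin n
  half c = (toℕ c * suc m) mod n

  half⊕half : ∀ c → half c ⊕ half c ≡ c
  half⊕half c = mod-≡ (toℕ (half c) + toℕ (half c)) (begin
    (toℕ (half c) + toℕ (half c)) % n ≡⟨ cong₂ (λ u v → (u + v) % n) (toℕ-mod x) (toℕ-mod x) ⟩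
    (x % n + x % n) % n               ≡⟨ %-distribˡ-+ x x n ⟨
    (x + x) % n                       ≡⟨ cong (_% n) (x+x≡c+c*n (toℕ c) m) ⟩
    (toℕ c + toℕ c * n) % n           ≡⟨ [m+kn]%n≡m%n (toℕ c) (toℕ c) n ⟩
    toℕ c % n                         ≡⟨ toℕ%n c ⟩
    toℕ c                             ∎)
    where
    open ≡-Reasoning
    x = toℕ c * suc m
    x+x≡c+c*n : ∀ c m → c * suc m + c * suc m ≡ c + c * suc (m * 2)
    x+x≡c+c*n = solve-∀

  half[a⊕a]≡a : ∀ a → half (a ⊕ a) ≡ a
  half[a⊕a]≡a a = mod-≡ (toℕ (a ⊕ a) * suc m) (begin
    (toℕ (a ⊕ a) * suc m) % n       ≡⟨ *-toℕ-mod (toℕ a + toℕ a) (suc m) ⟩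
    ((toℕ a + toℕ a) * suc m) % n   ≡⟨ cong (_% n) ([a+a]*[1+m]≡a+a*n (toℕ a) m) ⟩
    (toℕ a + toℕ a * n) % n         ≡⟨ [m+kn]%n≡m%n (toℕ a) (toℕ a) n ⟩
    toℕ a % n                       ≡⟨ toℕ%n a ⟩
    toℕ a                           ∎)
    where
    open ≡-Reasoning
    [a+a]*[1+m]≡a+a*n : ∀ a m → (a + a) * suc m ≡ a + a * suc (m * 2)
    [a+a]*[1+m]≡a+a*n = solve-∀

  ⊕-self-injective : ∀ {a b} → a ⊕ a ≡ b ⊕ b → a ≡ b
  ⊕-self-injective {a} {b} e = trans (sym (half[a⊕a]≡a a)) (trans (cong half e) (half[a⊕a]≡a b))

  -- The vertex zero plays ∞ and suc a plays a ∈ Z_n; colour zero zero is a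
  -- junk value on the diagonal, which no block uses.
  colour : Fin (suc n) → Fin (suc n) → Fin n
  colour zero zero = zero
  colour zero (suc b) = b ⊕ b
  colour (suc a) zero = a ⊕ a
  colour (suc a) (suc b) = a ⊕ b

  colour-sym : ∀ x y → colour x y ≡ colour y x
  colour-sym zero zero = refl
  colour-sym zero (suc b) = refl
  colour-sym (suc a) zero = refl
  colour-sym (suc a) (suc b) = ⊕-comm a b

  partner : Fin n → Fin (suc n) → Fin (suc n)
  partner c zero = suc (half c)
  partner c (suc a) with c ⊖ a ≟ a
  ... | yes _ = zero
  ... | no _ = suc (c ⊖ a)

  partner-≢ : ∀ c x → partner c x ≢ x
  partner-≢ c zero ()
  partner-≢ c (suc a) with c ⊖ a ≟ a
  ... | yes _ = λ ()
  ... | no c⊖a≢a = λ e → c⊖a≢a (suc-injective e)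

  colour-partner : ∀ c x → colour x (partner c x) ≡ c
  colour-partner c zero = half⊕half c
  colour-partner c (suc a) with c ⊖ a ≟ a
  ... | yes c⊖a≡a = subst (λ b → a ⊕ b ≡ c) c⊖a≡a (a⊕[c⊖a]≡c a c)
  ... | no _ = a⊕[c⊖a]≡c a c

  colour-injective : ∀ x {y y'} → y ≢ x → y' ≢ x → colour x y ≡ colour x y' → y ≡ y'
  colour-injective zero {zero} y≢x _ _ = ⊥-elim (y≢x refl)
  colour-injective zero {suc _} {zero} _ y'≢x _ = ⊥-elim (y'≢x refl)
  colour-injective zero {suc b} {suc b'} _ _ e = cong suc (⊕-self-injective e)
  colour-injective (suc a) {zero} {zero} _ _ _ = refl
  colour-injective (suc a) {zero} {suc b'} _ y'≢x e = ⊥-elim (y'≢x (cong suc (sym (⊕-cancelˡ a e))))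
  colour-injective (suc a) {suc b} {zero} y≢x _ e = ⊥-elim (y≢x (cong suc (⊕-cancelˡ a e)))
  colour-injective (suc a) {suc b} {suc b'} _ _ e = cong suc (⊕-cancelˡ a e)

  roundRobin : OneFactorization (suc n) n
  roundRobin = record
    { colour = colour
    ; colour-sym = colour-sym
    ; partner = partner
    ; partner-≢ = partner-≢
    ; colour-partner = colour-partner
    ; colour-injective = colour-injective
    }

partition-even : ∀ m → PartitionIntoParallelClasses (2 + m * 2) (1 + m * 2)
partition-even m = oneFactorization⇒partition (RoundRobin.roundRobin m)

lemma13 : (t : ℕ) → t % 4 ≡ 2 → PartitionIntoParallelClasses t (t ∸ 1)
lemma13 t t%4≡2 = subst (λ s → PartitionIntoParallelClasses s (s ∸ 1)) (sym t≡2+m*2) (partition-even (t / 4 * 2))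
  where
  open ≡-Reasoning
  t≡2+m*2 : t ≡ 2 + t / 4 * 2 * 2
  t≡2+m*2 = begin
    t                 ≡⟨ m≡m%n+[m/n]*n t 4 ⟩
    t % 4 + t / 4 * 4 ≡⟨ cong (_+ t / 4 * 4) t%4≡2 ⟩
    2 + t / 4 * 4     ≡⟨ cong (2 +_) (*-assoc (t / 4) 2 2) ⟨
    2 + t / 4 * 2 * 2 ∎
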